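{- Let $t$ be a positive integer. For any positive integers $a,b,c$ with $c\le a\le b$, $$\frac{\binom{c+t-1}{t}}{\binom{c+b-a+3t-1}{t}}\cdot\frac{\binom{b+3t-1}{t}}{\binom{a+t-1}{t}}\le 1.$$ -}

module Submission where

-- Write ((x k)) = (x + k - 1 choose k) for the number of k-element multisets
-- drawn from x kinds.  The theorem is the inequality
--     ((c t)) ((b+2t t)) ≤ ((c+b-a+2t t)) ((a t)),
-- an instance (x = c, d = a - c, z = b - a + 2t) of the exchange inequality
--     ((x k)) ((x+d+z k)) ≤ ((x+z k)) ((x+d k))          for all x d z k,
-- which says that x ↦ ((x k)) is log-concave in the sense of having
-- "decreasing ratios".  The exchange inequality is proved by induction on k:
--   * the absorption identity (n+1 choose k+1)(k+1) = (n+1)(n choose k),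
--     proved by Pascal's rule, gives the step ((x k+1))(k+1) = (x+k)((x k));
--   * the step factors satisfy (x+k)(x+d+z+k) ≤ (x+z+k)(x+d+k), the two
--     sides differing by exactly d·z;
--   * a cross-multiplication lemma combines the factor inequality with the
--     induction hypothesis and cancels the common factor (k+1)².

open import Data.Nat using (ℕ; _+_; _*_; _∸_; _≤_; _<_; zero; suc; s≤s; z≤n; NonZero)
open import Data.Nat.Combinatorics using (_C_; nCk+nC[k+1]≡[n+1]C[k+1]; nC1≡n; k>n⇒nCk≡0)
open import Data.Nat.Properties
  using (*-identityʳ; m*n≢0; *-cancelʳ-≤; *-mono-≤; m≤m+n; +-suc; +-∸-assoc; m+[n∸m]≡n; [m*n]*[o*p]≡[m*o]*[n*p]; ≤-refl; module ≤-Reasoning)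
open import Data.Nat.Tactic.RingSolver using (solve-∀)
open import Relation.Binary.PropositionalEquality using (_≡_; refl; sym; cong; cong₂; subst; subst₂; module ≡-Reasoning)

absorption : ∀ n k → (suc n C suc k) * suc k ≡ suc n * (n C k)
absorption zero zero = refl
absorption zero (suc k)
  rewrite k>n⇒nCk≡0 {1} {suc (suc k)} (s≤s (s≤s z≤n)) | k>n⇒nCk≡0 {0} {suc k} (s≤s z≤n) = refl
absorption (suc n) zero = begin
  (suc (suc n) C 1) * 1 ≡⟨ *-identityʳ _ ⟩
  suc (suc n) C 1       ≡⟨ nC1≡n (suc (suc n)) ⟩
  suc (suc n)           ≡⟨ sym (*-identityʳ _) ⟩
  suc (suc n) * 1       ∎
  where open ≡-Reasoning
absorption (suc n) (suc k) = begin
  (suc (suc n) C suc (suc k)) * suc (suc k)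
    ≡⟨ cong (_* suc (suc k)) (sym (nCk+nC[k+1]≡[n+1]C[k+1] (suc n) (suc k))) ⟩
  (P + Q) * suc (suc k)
    ≡⟨ regroup P Q k ⟩
  P * suc k + P + Q * suc (suc k)
    ≡⟨ cong₂ (λ u v → u + P + v) (absorption n k) (absorption n (suc k)) ⟩
  suc n * (n C k) + P + suc n * (n C suc k)
    ≡⟨ collect (n C k) (n C suc k) P n ⟩
  suc n * (n C k + n C suc k) + P
    ≡⟨ cong (λ w → suc n * w + P) (nCk+nC[k+1]≡[n+1]C[k+1] n k) ⟩
  suc n * P + P
    ≡⟨ finish n P ⟩
  suc (suc n) * P ∎
  where
  open ≡-Reasoning
  P = suc n C suc k
  Q = suc n C suc (suc k)
  regroup : ∀ p q k → (p + q) * suc (suc k) ≡ p * suc k + p + q * suc (suc k)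
  regroup = solve-∀
  collect : ∀ u v p n → suc n * u + p + suc n * v ≡ suc n * (u + v) + p
  collect = solve-∀
  finish : ∀ n p → suc n * p + p ≡ suc (suc n) * p
  finish = solve-∀

multiset : ℕ → ℕ → ℕ
multiset x k = (x + k ∸ 1) C k

-- Recurrence of the multiset coefficients in k: ((x k+1))·(k+1) = (x+k)·((x k)).
-- When x + k = 0 both sides vanish; otherwise it is absorption.
multiset-step : ∀ x k → multiset x (suc k) * suc k ≡ (x + k) * multiset x k
multiset-step x k rewrite +-suc x k = absorption′ (x + k)
  where
  absorption′ : ∀ m → (m C suc k) * suc k ≡ m * ((m ∸ 1) C k)
  absorption′ zero    rewrite k>n⇒nCk≡0 {0} {suc k} (s≤s z≤n) = refl
  absorption′ (suc n) = absorption n k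

step-factor-exchange : ∀ x d z k → (x + k) * (x + d + z + k) ≤ (x + z + k) * (x + d + k)
step-factor-exchange x d z k =
  subst ((x + k) * (x + d + z + k) ≤_) (difference x d z k) (m≤m+n _ (d * z))
  where
  difference : ∀ x d z k → (x + k) * (x + d + z + k) + d * z ≡ (x + z + k) * (x + d + k)
  difference = solve-∀

cross-multiply : ∀ s .{{_ : NonZero s}} {f₁ f₂ g₁ g₂ r₁ r₂ ρ₁ ρ₂ e₁ e₂ ε₁ ε₂ : ℕ} →
  f₁ * s ≡ r₁ * e₁ → f₂ * s ≡ r₂ * e₂ → g₁ * s ≡ ρ₁ * ε₁ → g₂ * s ≡ ρ₂ * ε₂ →
  r₁ * r₂ ≤ ρ₁ * ρ₂ → e₁ * e₂ ≤ ε₁ * ε₂ → f₁ * f₂ ≤ g₁ * g₂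
cross-multiply s {f₁} {f₂} {g₁} {g₂} {r₁} {r₂} {ρ₁} {ρ₂} {e₁} {e₂} {ε₁} {ε₂}
               f₁≡ f₂≡ g₁≡ g₂≡ r≤ρ e≤ε = *-cancelʳ-≤ _ _ (s * s) {{m*n≢0 s s}} (begin
  (f₁ * f₂) * (s * s)         ≡⟨ [m*n]*[o*p]≡[m*o]*[n*p] f₁ f₂ s s ⟩
  (f₁ * s) * (f₂ * s)         ≡⟨ cong₂ _*_ f₁≡ f₂≡ ⟩
  (r₁ * e₁) * (r₂ * e₂)       ≡⟨ [m*n]*[o*p]≡[m*o]*[n*p] r₁ e₁ r₂ e₂ ⟩
  (r₁ * r₂) * (e₁ * e₂)       ≤⟨ *-mono-≤ r≤ρ e≤ε ⟩
  (ρ₁ * ρ₂) * (ε₁ * ε₂)       ≡⟨ [m*n]*[o*p]≡[m*o]*[n*p] ρ₁ ε₁ ρ₂ ε₂ ⟨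
  (ρ₁ * ε₁) * (ρ₂ * ε₂)       ≡⟨ cong₂ _*_ g₁≡ g₂≡ ⟨
  (g₁ * s) * (g₂ * s)         ≡⟨ [m*n]*[o*p]≡[m*o]*[n*p] g₁ g₂ s s ⟨
  (g₁ * g₂) * (s * s)         ∎)
  where open ≤-Reasoning

multiset-exchange : ∀ k x d z →
  multiset x k * multiset (x + d + z) k ≤ multiset (x + z) k * multiset (x + d) k
multiset-exchange zero    x d z = ≤-refl
-- The new values and ratios are supplied explicitly: they cannot be inferred
-- from products such as (x + k) * multiset x k.
multiset-exchange (suc k) x d z =
  cross-multiply (suc k)
    {f₁ = multiset x (suc k)} {multiset (x + d + z) (suc k)}
    {multiset (x + z) (suc k)} {multiset (x + d) (suc k)}
    {x + k} {x + d + z + k} {x + z + k} {x + d + k}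
    (multiset-step x k) (multiset-step (x + d + z) k)
    (multiset-step (x + z) k) (multiset-step (x + d) k)
    (step-factor-exchange x d z k) (multiset-exchange k x d z)

multiset-as-binomial : ∀ x k {m} → x + k ≡ m → multiset x k ≡ (m ∸ 1) C k
multiset-as-binomial x k eq = cong (λ m → (m ∸ 1) C k) eq

lemma3 : (t a b c : ℕ) → 0 < t → 0 < a → 0 < b → 0 < c → c ≤ a → a ≤ b →
    ((c + t ∸ 1) C t) * ((b + 3 * t ∸ 1) C t)
      ≤ ((c + b ∸ a + 3 * t ∸ 1) C t) * ((a + t ∸ 1) C t)
lemma3 t a b c _ _ _ _ c≤a a≤b =
  subst₂ _≤_
    (cong (multiset c t *_) (multiset-as-binomial (c + d + z) t top))
    (cong₂ _*_ (multiset-as-binomial (c + z) t shifted)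
               (multiset-as-binomial (c + d) t (cong (_+ t) c+d≡a)))
    (multiset-exchange t c d z)
  where
  open ≡-Reasoning
  d = a ∸ c
  z = b ∸ a + 2 * t
  c+d≡a : c + d ≡ a
  c+d≡a = m+[n∸m]≡n c≤a
  spread : ∀ x e t → x + (e + 2 * t) + t ≡ x + e + 3 * t
  spread = solve-∀
  top : c + d + z + t ≡ b + 3 * t
  top = begin
    c + d + z + t           ≡⟨ cong (λ w → w + z + t) c+d≡a ⟩
    a + (b ∸ a + 2 * t) + t ≡⟨ spread a (b ∸ a) t ⟩
    a + (b ∸ a) + 3 * t     ≡⟨ cong (_+ 3 * t) (m+[n∸m]≡n a≤b) ⟩
    b + 3 * t               ∎
  shifted : c + z + t ≡ c + b ∸ a + 3 * t
  shifted = begin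
    c + (b ∸ a + 2 * t) + t ≡⟨ spread c (b ∸ a) t ⟩
    c + (b ∸ a) + 3 * t     ≡⟨ cong (_+ 3 * t) (+-∸-assoc c a≤b) ⟨
    c + b ∸ a + 3 * t       ∎
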